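{- The language of URC formulas is strictly more succinct than the language of PC formulas. That is: (i) there is a polynomial $p$ such that every PC formula $\varphi$ has an equivalent URC formula $\psi$ with $|\psi|\le p(|\varphi|)$; and (ii) there is no polynomial $p$ such that every URC formula $\varphi$ has an equivalent PC formula $\psi$ with $|\psi|\le p(|\varphi|)$.
   Context: A CNF formula is a conjunction (set) of clauses; a clause is a disjunction (set) of literals; $|\varphi|$ denotes the number of clauses of $\varphi$. A partial assignment $\alpha$ of variables $\mathbf{x}$ is a set of literals on $\mathbf{x}$ containing no complementary pair; it is identified with the conjunction of its literals. The unit resolution rule derives the clause $C\setminus\{l\}$ from a clause $C\ni l$ and the unit clause $\neg l$; $\varphi\vdash_1 C$ means $C$ can be derived from $\varphi$ by repeated applications of this rule, and $\bot$ denotes the empty clause. A CNF formula $\varphi(\mathbf{x})$ is unit refutation complete (URC) if for every partial assignment $\alpha$ of $\mathbf{x}$, $\varphi\wedge\alpha\models\bot$ implies $\varphi\wedge\alpha\vdash_1\bot$. It is propagation complete (PC) if for every partial assignment $\alpha$ of $\mathbf{x}$ and every literal $l$ on $\mathbf{x}$ with $\varphi\wedge\alpha\models l$, we have $\varphi\wedge\alpha\vdash_1 l$ or $\varphi\wedge\alpha\vdash_1\bot$. URC formulas and PC formulas are formulas using no auxiliary variables, and "equivalent" means representing the same Boolean function on the same variables. For representation languages $L_1,L_2$: $L_1$ is at least as succinct as $L_2$ iff there is a polynomial $p$ such that for every $\varphi\in L_2$ there is an equivalent $\psi\in L_1$ with $|\psi|\le p(|\varphi|)$; $L_1$ is strictly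 more succinct than $L_2$ if $L_1$ is at least as succinct as $L_2$ but not vice versa. -}

module Defs where

open import Data.Nat using (ℕ; _+_; _*_; _^_; _≤_)
open import Data.Fin using (Fin)
import Data.Fin as Fin
open import Data.Bool using (Bool; true; false; not)
import Data.Bool as Bool
open import Data.List using (List; []; _∷_; _++_; map; filter; length)
open import Data.List.Membership.Propositional using (_∈_)
open import Data.List.Relation.Unary.All using (All)
open import Data.List.Relation.Unary.Any using (Any)
open import Data.Product using (Σ; ∃; _×_; _,_)
open import Data.Sum using (_⊎_)
open import Relation.Nullary using (¬_; Dec; yes; no; ¬?)
open import Relation.Binary.PropositionalEquality using (_≡_; refl; cong₂)
open import Function.Bundles using (_⇔_)

-- A literal on variables Fin n: a variable with a polarity (true = positive).
record Literal (n : ℕ) : Set where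
  constructor lit
  field
    var : Fin n
    pol : Bool
open Literal public

neg : ∀ {n} → Literal n → Literal n
neg (lit v b) = lit v (not b)

_≟L_ : ∀ {n} (l l′ : Literal n) → Dec (l ≡ l′)
lit v b ≟L lit w c with v Fin.≟ w | b Bool.≟ c
... | yes refl | yes refl = yes refl
... | no v≢w   | _        = no λ { refl → v≢w refl }
... | yes _    | no b≢c   = no λ { refl → b≢c refl }

-- Clauses (disjunctions) and CNF formulas (conjunctions), represented by lists;
-- a clause is regarded as the set of its elements.
Clause : ℕ → Set
Clause n = List (Literal n)

CNF : ℕ → Set
CNF n = List (Clause n)

size : ∀ {n} → CNF n → ℕ
size = length

SameSet : ∀ {n} → Clause n → Clause n → Set
SameSet C D = ∀ x → (x ∈ C) ⇔ (x ∈ D)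

remove : ∀ {n} → Literal n → Clause n → Clause n
remove l C = filter (λ x → ¬? (x ≟L l)) C

Assignment : ℕ → Set
Assignment n = Fin n → Bool

LitTrue : ∀ {n} → Assignment n → Literal n → Set
LitTrue a (lit v b) = a v ≡ b

SatClause : ∀ {n} → Assignment n → Clause n → Set
SatClause a C = Any (LitTrue a) C

SatCNF : ∀ {n} → Assignment n → CNF n → Set
SatCNF a φ = All (SatClause a) φ

_⊨_ : ∀ {n} → CNF n → Clause n → Set
φ ⊨ C = ∀ a → SatCNF a φ → SatClause a C

data Derives {n} (φ : CNF n) : Clause n → Set where
  axiom : ∀ {C} → C ∈ φ → Derives φ C
  unit  : ∀ {C D l} → Derives φ C → l ∈ C →
          Derives φ D → SameSet D (neg l ∷ []) →
          Derives φ (remove l C)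

_⊢₁_ : ∀ {n} → CNF n → Clause n → Set
φ ⊢₁ C = Σ _ λ D → Derives φ D × SameSet D C

PartialAssignment : ∀ {n} → List (Literal n) → Set
PartialAssignment α = ∀ l → l ∈ α → ¬ (neg l ∈ α)

_∧α_ : ∀ {n} → CNF n → List (Literal n) → CNF n
φ ∧α α = φ ++ map (λ l → l ∷ []) α

⊥c : ∀ {n} → Clause n
⊥c = []

URC : ∀ {n} → CNF n → Set
URC φ = ∀ α → PartialAssignment α → (φ ∧α α) ⊨ ⊥c → (φ ∧α α) ⊢₁ ⊥c

PC : ∀ {n} → CNF n → Set
PC φ = ∀ α → PartialAssignment α → ∀ l →
       (φ ∧α α) ⊨ (l ∷ []) → ((φ ∧α α) ⊢₁ (l ∷ [])) ⊎ ((φ ∧α α) ⊢₁ ⊥c)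

Equivalent : ∀ {n} → CNF n → CNF n → Set
Equivalent φ ψ = ∀ a → SatCNF a φ ⇔ SatCNF a ψ

-- A language of (auxiliary-variable-free) CNF formulas
Language : Set₁
Language = ∀ {n} → CNF n → Set

-- Polynomial bound: every polynomial on ℕ is dominated by c·m^k + c, and these are polynomials.
AtLeastAsSuccinct : Language → Language → Set
AtLeastAsSuccinct L₁ L₂ =
  ∃ λ c → ∃ λ k → ∀ n (φ : CNF n) → L₂ φ →
    Σ (CNF n) λ ψ → L₁ ψ × Equivalent φ ψ × size ψ ≤ c * size φ ^ k + c

module Submission where

-- A PC formula is URC: if φ ∧ α is unsatisfiable it entails both x and ¬x, so unit
-- resolution derives ⊥ or both units, and then ⊥.
--
-- For the separation take, for K ≥ 2, the 2K + 1 clauses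
--   χ = (z₁ ∨ … ∨ z_K) ∧ ⋀_{p,s} (¬z_p ∨ ℓ ∨ y_{s,p})      (s ranging over two sides).
-- χ is URC: either α falsifies some clause ¬z_p ∨ ℓ ∨ y_{s,p} outright, or unit resolution
-- derives every ¬z_p, or some z_p survives and α extends to a model.
-- For each choice σ of one side per index, α_σ = {¬y_{σ(p),p}} makes χ entail ℓ, so an
-- equivalent PC formula ψ contains a clause that α_σ reduces to the unit ℓ (or to ⊥).
-- Enough models of χ exist to force that clause to be exactly ℓ ∨ ⋁_p y_{σ(p),p}, so
-- distinct σ give distinct clauses and |ψ| ≥ 2^K, which outgrows every polynomial in 2K + 1.

open import Defs
open import Data.Bool using (Bool; true; false; not; _∧_)
open import Data.Bool.Properties using (not-¬; ∧-zeroʳ)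
open import Data.Empty using (⊥; ⊥-elim)
open import Data.Fin using (Fin; zero; suc; _↑ˡ_; _↑ʳ_; splitAt; join; combine; remQuot; funToFin; finToFun; punchIn)
import Data.Fin.Properties as Fin
open import Data.List using (List; []; _∷_; _++_; map; tabulate; length; lookup)
open import Data.List.Properties using (length-++; length-tabulate)
open import Data.List.Membership.Propositional using (_∈_; _∉_; find; lose)
open import Data.List.Membership.Propositional.Properties using (∈-filter⁺; ∈-filter⁻; ∈-++⁺ˡ; ∈-++⁺ʳ; ∈-map⁺; ∈-tabulate⁺; ∈-tabulate⁻)
open import Data.List.Relation.Unary.Any as Any using (Any; here; there; any?)
open import Data.List.Relation.Unary.Any.Properties using (singleton⁻)
open import Data.List.Relation.Unary.All as All using (All; []; _∷_; all?)
open import Data.List.Relation.Unary.All.Properties using (¬All⇒Any¬)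
import Data.List.Relation.Unary.All.Properties as All
import Data.List.Relation.Unary.Any.Properties as Any
open import Data.Nat using (ℕ; zero; suc; _+_; _*_; _^_; _≤_; _<_; z≤n; s≤s)
open import Data.Nat.Properties
open import Data.Nat.Tactic.RingSolver using (solve-∀)
open import Data.Product using (Σ; ∃-syntax; _×_; _,_; proj₁; proj₂; uncurry)
open import Data.Sum using (_⊎_; inj₁; inj₂; [_,_]′)
open import Function using (_∘_)
open import Function.Bundles using (mk⇔; Equivalence)
import Function.Properties.Equivalence as ⇔
open import Relation.Nullary using (¬_; Dec; yes; no; ¬?; does)
open import Relation.Nullary.Decidable using (_⊎-dec_; _×-dec_; dec-true; dec-false)
open import Relation.Binary.PropositionalEquality using (_≡_; _≢_; refl; sym; trans; cong; cong₂; subst; module ≡-Reasoning)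

open Equivalence using (to; from)

module _ {n : ℕ} where

  open import Data.List.Membership.DecPropositional (_≟L_ {n}) public using (_∈?_)

  ∈-remove⁻ : ∀ {l x} {C : Clause n} → x ∈ remove l C → x ∈ C × x ≢ l
  ∈-remove⁻ {l} = ∈-filter⁻ (λ y → ¬? (y ≟L l))

  ∈-remove⁺ : ∀ {l x} {C : Clause n} → x ∈ C → x ≢ l → x ∈ remove l C
  ∈-remove⁺ {l} = ∈-filter⁺ (λ y → ¬? (y ≟L l))

  LitTrue-neg : ∀ {M : Assignment n} {l} → LitTrue M l → ¬ LitTrue M (neg l)
  LitTrue-neg {l = lit v b} Mv≡b Mv≡¬b = not-¬ refl (trans (sym Mv≡b) Mv≡¬b)

  SameSet-trans : {C D E : Clause n} → SameSet C D → SameSet D E → SameSet C E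
  SameSet-trans C≈D D≈E x = ⇔.trans (C≈D x) (D≈E x)

  module _ {φ : CNF n} where

    ⊢₁-axiom : ∀ {C} → C ∈ φ → φ ⊢₁ C
    ⊢₁-axiom C∈φ = _ , axiom C∈φ , λ _ → ⇔.refl

    ⊢₁-cong : ∀ {C D} → SameSet C D → φ ⊢₁ C → φ ⊢₁ D
    ⊢₁-cong C≈D (E , E-der , E≈C) = E , E-der , SameSet-trans E≈C C≈D

    ⊢₁-remove : ∀ {C l} → φ ⊢₁ C → φ ⊢₁ (neg l ∷ []) → φ ⊢₁ remove l C
    ⊢₁-remove {C} {l} (D , D-der , D≈C) (U , U-der , U≈¬l) with l ∈? D
    ... | yes l∈D = remove l D , unit D-der l∈D U-der U≈¬l , λ x →
            mk⇔ (λ x∈ → let x∈D , x≢l = ∈-remove⁻ x∈ in ∈-remove⁺ (to (D≈C x) x∈D) x≢l)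
                (λ x∈ → let x∈C , x≢l = ∈-remove⁻ x∈ in ∈-remove⁺ (from (D≈C x) x∈C) x≢l)
    ... | no l∉D = D , D-der , λ x →
            mk⇔ (λ x∈D → ∈-remove⁺ (to (D≈C x) x∈D) λ { refl → l∉D x∈D })
                (λ x∈ → from (D≈C x) (proj₁ (∈-remove⁻ x∈)))

    ⊢₁-remove-all : ∀ {C} R → φ ⊢₁ C → All (λ r → φ ⊢₁ (neg r ∷ [])) R →
                    Σ (Clause n) λ D → φ ⊢₁ D × (∀ {x} → x ∈ D → x ∈ C × x ∉ R) × (∀ {x} → x ∈ C → x ∉ R → x ∈ D)
    ⊢₁-remove-all [] ⊢C [] = _ , ⊢C , (λ x∈C → x∈C , λ ()) , λ x∈C _ → x∈C
    ⊢₁-remove-all (r ∷ R) ⊢C (⊢¬r ∷ ⊢¬R) with ⊢₁-remove-all R ⊢C ⊢¬R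
    ... | D , ⊢D , D⊆C∖R , C∖R⊆D =
      remove r D , ⊢₁-remove ⊢D ⊢¬r ,
      (λ x∈ → let x∈D , x≢r = ∈-remove⁻ x∈ ; x∈C , x∉R = D⊆C∖R x∈D in
              x∈C , λ { (here x≡r) → x≢r x≡r ; (there x∈R) → x∉R x∈R }) ,
      λ x∈C x∉rR → ∈-remove⁺ (C∖R⊆D x∈C (x∉rR ∘ there)) (x∉rR ∘ here)

    ⊢₁-conflict : ∀ {C} → φ ⊢₁ C → All (λ r → φ ⊢₁ (neg r ∷ [])) C → φ ⊢₁ ⊥c
    ⊢₁-conflict {C} ⊢C ⊢¬C with ⊢₁-remove-all C ⊢C ⊢¬C
    ... | D , ⊢D , D⊆C∖C , _ = ⊢₁-cong (λ x → mk⇔ (λ x∈D → let x∈C , x∉C = D⊆C∖C x∈D in ⊥-elim (x∉C x∈C)) λ ()) ⊢D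

    ⊢₁-unit : ∀ {x R} → φ ⊢₁ (x ∷ R) → x ∉ R → All (λ r → φ ⊢₁ (neg r ∷ [])) R → φ ⊢₁ (x ∷ [])
    ⊢₁-unit {x} {R} ⊢xR x∉R ⊢¬R with ⊢₁-remove-all R ⊢xR ⊢¬R
    ... | D , ⊢D , D⊆xR∖R , xR∖R⊆D = ⊢₁-cong (λ x′ → mk⇔ only-x λ { (here refl) → xR∖R⊆D (here refl) x∉R }) ⊢D
      where
        only-x : ∀ {x′} → x′ ∈ D → x′ ∈ x ∷ []
        only-x x′∈D with D⊆xR∖R x′∈D
        ... | here x′≡x  , _   = here x′≡x
        ... | there x′∈R , x′∉R = ⊥-elim (x′∉R x′∈R)

    ⊢₁-complementary : ∀ {l} → φ ⊢₁ (l ∷ []) → φ ⊢₁ (neg l ∷ []) → φ ⊢₁ ⊥c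
    ⊢₁-complementary ⊢l ⊢¬l = ⊢₁-conflict ⊢l (⊢¬l ∷ [])

CNF₀-URC : (φ : CNF 0) → φ ⊨ ⊥c → φ ⊢₁ ⊥c
CNF₀-URC []                    ⊨⊥ with () ← ⊨⊥ (λ ()) []
CNF₀-URC ([] ∷ φ)              ⊨⊥ = ⊢₁-axiom (here refl)
CNF₀-URC ((lit () _ ∷ _) ∷ φ) ⊨⊥

PC⇒URC : ∀ {n} {φ : CNF n} → PC φ → URC φ
PC⇒URC {zero}  {φ} _  α _  ⊨⊥ = CNF₀-URC (φ ∧α α) ⊨⊥
PC⇒URC {suc n}     pc α pa ⊨⊥
  with pc α pa (lit zero true) (λ a a⊨ → ⊥-elim (⊥-clause (⊨⊥ a a⊨)))
     | pc α pa (lit zero false) (λ a a⊨ → ⊥-elim (⊥-clause (⊨⊥ a a⊨)))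
  where
    ⊥-clause : ∀ {a : Assignment (suc n)} → ¬ SatClause a ⊥c
    ⊥-clause ()
... | inj₂ ⊢⊥  | _          = ⊢⊥
... | inj₁ _   | inj₂ ⊢⊥    = ⊢⊥
... | inj₁ ⊢x  | inj₁ ⊢¬x   = ⊢₁-complementary ⊢x ⊢¬x

module _ {n : ℕ} where

  -- Satisfied by α, or keeping two distinct literals that α does not falsify.  Resolving
  -- with units of α preserves this, and an inert clause is neither empty nor a unit
  -- outside α: so a PC formula that must propagate a new unit has a clause that is not inert.
  Inert : List (Literal n) → Clause n → Set
  Inert α C = Any (_∈ α) C ⊎ Any (λ x → neg x ∉ α × Any (λ y → x ≢ y × neg y ∉ α) C) C

  inert? : ∀ α C → Dec (Inert α C)
  inert? α C = any? (_∈? α) C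
           ⊎-dec any? (λ x → ¬? (neg x ∈? α) ×-dec any? (λ y → ¬? (x ≟L y) ×-dec ¬? (neg y ∈? α)) C) C

  record Propagating (α : List (Literal n)) (C : Clause n) : Set where
    field
      unsatisfied : ∀ {x} → x ∈ C → x ∉ α
      unfalsified-unique : ∀ {x y} → x ∈ C → y ∈ C → neg x ∉ α → neg y ∉ α → x ≡ y

  ¬inert⇒propagating : ∀ {α C} → ¬ Inert α C → Propagating α C
  ¬inert⇒propagating {α} {C} ¬inert = record
    { unsatisfied = λ x∈C x∈α → ¬inert (inj₁ (lose x∈C x∈α))
    ; unfalsified-unique = unique
    }
    where
      unique : ∀ {x y} → x ∈ C → y ∈ C → neg x ∉ α → neg y ∉ α → x ≡ y
      unique {x} {y} x∈C y∈C ¬x∉α ¬y∉α with x ≟L y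
      ... | yes x≡y = x≡y
      ... | no x≢y  = ⊥-elim (¬inert (inj₂ (lose x∈C (¬x∉α , lose y∈C (x≢y , ¬y∉α)))))

  module _ {α : List (Literal n)} where

    inert-unit : ∀ {D m} → Inert α D → SameSet D (m ∷ []) → m ∈ α
    inert-unit (inj₁ sat) D≈m with find sat
    ... | x , x∈D , x∈α with singleton⁻ (to (D≈m x) x∈D)
    ... | refl = x∈α
    inert-unit (inj₂ two) D≈m with find two
    ... | x , x∈D , _ , others with find others
    ... | y , y∈D , x≢y , _ = ⊥-elim (x≢y (trans (singleton⁻ (to (D≈m x) x∈D)) (sym (singleton⁻ (to (D≈m y) y∈D)))))

    inert-nonempty : ∀ {D} → Inert α D → ¬ SameSet D ⊥c
    inert-nonempty (inj₁ sat) D≈⊥ with () ← to (D≈⊥ _) (proj₁ (proj₂ (find sat)))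
    inert-nonempty (inj₂ two) D≈⊥ with () ← to (D≈⊥ _) (proj₁ (proj₂ (find two)))

    inert-remove : PartialAssignment α → ∀ {C l} → neg l ∈ α → Inert α C → Inert α (remove l C)
    inert-remove pa {l = l} ¬l∈α (inj₁ sat) with find sat
    ... | x , x∈C , x∈α = inj₁ (lose (∈-remove⁺ x∈C λ { refl → pa x x∈α ¬l∈α }) x∈α)
    inert-remove pa {l = l} ¬l∈α (inj₂ two) with find two
    ... | x , x∈C , ¬x∉α , others with find others
    ... | y , y∈C , x≢y , ¬y∉α =
      inj₂ (lose (∈-remove⁺ x∈C λ { refl → ¬x∉α ¬l∈α })
                 (¬x∉α , lose (∈-remove⁺ y∈C λ { refl → ¬y∉α ¬l∈α }) (x≢y , ¬y∉α)))

    derives-inert : PartialAssignment α → ∀ {φ C} → All (Inert α) φ → Derives φ C → Inert α C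
    derives-inert pa inert (axiom C∈φ) = All.lookup inert C∈φ
    derives-inert pa inert (unit C-der _ D-der D≈¬l) =
      inert-remove pa (inert-unit (derives-inert pa inert D-der) D≈¬l) (derives-inert pa inert C-der)

PC⇒propagating : ∀ {n} {φ : CNF n} {α l} → PC φ → PartialAssignment α → l ∉ α →
                 (φ ∧α α) ⊨ (l ∷ []) → Any (Propagating α) φ
PC⇒propagating {φ = φ} {α} {l} pc pa l∉α ⊨l with all? (inert? α) φ
... | no ¬all = Any.map ¬inert⇒propagating (¬All⇒Any¬ (inert? α) φ ¬all)
... | yes all-inert = ⊥-elim (unit-resolution-stuck (pc α pa l ⊨l))
  where
    φ∧α-inert : All (Inert α) (φ ∧α α)
    φ∧α-inert = All.++⁺ all-inert (All.map⁺ (All.tabulate λ l∈α → inj₁ (here l∈α)))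

    unit-resolution-stuck : ((φ ∧α α) ⊢₁ (l ∷ [])) ⊎ ((φ ∧α α) ⊢₁ ⊥c) → ⊥
    unit-resolution-stuck (inj₁ (D , D-der , D≈l)) = l∉α (inert-unit (derives-inert pa φ∧α-inert D-der) D≈l)
    unit-resolution-stuck (inj₂ (D , D-der , D≈⊥)) = inert-nonempty (derives-inert pa φ∧α-inert D-der) D≈⊥

module _ {n : ℕ} where

  _◃_ : List (Literal n) → Assignment n → Assignment n
  (α ◃ d) v with lit v true ∈? α | lit v false ∈? α
  ... | yes _ | _     = true
  ... | no _  | yes _ = false
  ... | no _  | no _  = d v

  ◃-agrees : ∀ {α d} → PartialAssignment α → ∀ {l} → l ∈ α → LitTrue (α ◃ d) l
  ◃-agrees {α} pa {lit v true} l∈α with lit v true ∈? α | lit v false ∈? α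
  ... | yes _  | _     = refl
  ... | no l∉α | _     = ⊥-elim (l∉α l∈α)
  ◃-agrees {α} pa {lit v false} l∈α with lit v true ∈? α | lit v false ∈? α
  ... | yes ¬l∈α | _      = ⊥-elim (pa _ l∈α ¬l∈α)
  ... | no _     | yes _  = refl
  ... | no _     | no l∉α = ⊥-elim (l∉α l∈α)

  ◃-default : ∀ {α d l} → neg l ∉ α → LitTrue d l → LitTrue (α ◃ d) l
  ◃-default {α} {l = lit v true} ¬l∉α dv with lit v true ∈? α | lit v false ∈? α
  ... | yes _ | _       = refl
  ... | no _  | yes ¬l∈α = ⊥-elim (¬l∉α ¬l∈α)
  ... | no _  | no _     = dv
  ◃-default {α} {l = lit v false} ¬l∉α dv with lit v true ∈? α | lit v false ∈? α
  ... | yes ¬l∈α | _     = ⊥-elim (¬l∉α ¬l∈α)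
  ... | no _     | yes _ = refl
  ... | no _     | no _  = dv

⊨-∧α-equivalent : ∀ {n} {φ ψ : CNF n} {α C} → Equivalent φ ψ → (φ ∧α α) ⊨ C → (ψ ∧α α) ⊨ C
⊨-∧α-equivalent {ψ = ψ} φ≡ψ φ∧α⊨C M M⊨ with M⊨ψ , M⊨α ← All.++⁻ ψ M⊨ =
  φ∧α⊨C M (All.++⁺ (from (φ≡ψ M) M⊨ψ) M⊨α)

funToFin-cong : ∀ {m n} {f g : Fin m → Fin n} → (∀ i → f i ≡ g i) → funToFin f ≡ funToFin g
funToFin-cong {zero}  _   = refl
funToFin-cong {suc m} f≗g = cong₂ combine (f≗g zero) (funToFin-cong (f≗g ∘ suc))

^≤length : ∀ {A : Set} {m K} (xs : List A) (f : (Fin K → Fin m) → A) → (∀ σ → f σ ∈ xs) →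
           (∀ {σ τ} → f σ ≡ f τ → ∀ p → σ p ≡ τ p) → m ^ K ≤ length xs
^≤length {m = m} {K} xs f f∈xs f-injective = Fin.injective⇒≤ position-injective
  where
    toFun : Fin (m ^ K) → Fin K → Fin m
    toFun = finToFun

    position : Fin (m ^ K) → Fin (length xs)
    position i = Any.index (f∈xs (toFun i))

    position-injective : ∀ {i j} → position i ≡ position j → i ≡ j
    position-injective {i} {j} same-position = begin
      i                    ≡⟨ sym (Fin.funToFin-finToFin {K} {m} i) ⟩
      funToFin (toFun i)   ≡⟨ funToFin-cong (f-injective same-f) ⟩
      funToFin (toFun j)   ≡⟨ Fin.funToFin-finToFin {K} {m} j ⟩
      j                    ∎
      where
        open ≡-Reasoning
        same-f : f (toFun i) ≡ f (toFun j)
        same-f = trans (Any.lookup-index (f∈xs (toFun i)))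
                       (trans (cong (lookup xs) same-position) (sym (Any.lookup-index (f∈xs (toFun j)))))

data Var (K : ℕ) : Set where
  ℓ : Var K
  z : Fin K → Var K
  y : Fin 2 → Fin K → Var K

module Family (K : ℕ) where

  N : ℕ
  N = suc (K + 2 * K)

  encode : Var K → Fin N
  encode ℓ       = zero
  encode (z p)   = suc (p ↑ˡ 2 * K)
  encode (y s p) = suc (K ↑ʳ combine s p)

  decode : Fin N → Var K
  decode zero    = ℓ
  decode (suc i) = [ z , uncurry y ∘ remQuot K ]′ (splitAt K i)

  decode-encode : ∀ v → decode (encode v) ≡ v
  decode-encode ℓ = refl
  decode-encode (z p)   = cong [ z , uncurry y ∘ remQuot K ]′ (Fin.splitAt-↑ˡ K p (2 * K))
  decode-encode (y s p) = trans (cong [ z , uncurry y ∘ remQuot K ]′ (Fin.splitAt-↑ʳ K (2 * K) (combine s p)))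
                                (cong (uncurry y) (Fin.remQuot-combine s p))

  encode-decode : ∀ i → encode (decode i) ≡ i
  encode-decode zero = refl
  encode-decode (suc i) with splitAt K i in split
  ... | inj₁ p = cong suc (trans (cong (join K (2 * K)) (sym split)) (Fin.join-splitAt K (2 * K) i))
  ... | inj₂ j = cong suc (trans (cong (K ↑ʳ_) (Fin.combine-remQuot {2} K j))
                                 (trans (cong (join K (2 * K)) (sym split)) (Fin.join-splitAt K (2 * K) i)))

  encode-injective : ∀ {u v} → encode u ≡ encode v → u ≡ v
  encode-injective {u} {v} eq = trans (sym (decode-encode u)) (trans (cong decode eq) (decode-encode v))

  infix 30 _⁺ _⁻
  _⁺ _⁻ : Var K → Literal N
  v ⁺ = lit (encode v) true
  v ⁻ = lit (encode v) false

  Zs : Clause N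
  Zs = tabulate (λ p → z p ⁺)

  R : Fin 2 → Fin K → Clause N
  R s p = z p ⁻ ∷ ℓ ⁺ ∷ y s p ⁺ ∷ []

  χ : CNF N
  χ = Zs ∷ tabulate (R zero) ++ tabulate (R (suc zero))

  size-χ : size χ ≡ suc (K + K)
  size-χ = cong suc (trans (length-++ (tabulate (R zero))) (cong₂ _+_ (length-tabulate (R zero)) (length-tabulate (R (suc zero)))))

  R∈χ : ∀ s p → R s p ∈ χ
  R∈χ zero       p = there (∈-++⁺ˡ (∈-tabulate⁺ p))
  R∈χ (suc zero) p = there (∈-++⁺ʳ (tabulate (R zero)) (∈-tabulate⁺ p))

  χ-sat : ∀ {M} p → LitTrue M (z p ⁺) → (∀ s q → SatClause M (R s q)) → SatCNF M χ
  χ-sat p zp R-sat = Any.tabulate⁺ p zp ∷ All.++⁺ (All.tabulate⁺ (R-sat zero)) (All.tabulate⁺ (R-sat (suc zero)))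

  ⟦_⟧ : (Var K → Bool) → Assignment N
  ⟦ g ⟧ = g ∘ decode

  ⟦⟧-lit : ∀ g v {b} → g v ≡ b → LitTrue ⟦ g ⟧ (lit (encode v) b)
  ⟦⟧-lit g v gv≡b = trans (cong g (decode-encode v)) gv≡b

  module χ-refutation (α : List (Literal N)) (pa : PartialAssignment α) where

    Conflict : Fin 2 → Fin K → Set
    Conflict s q = z q ⁺ ∈ α × ℓ ⁻ ∈ α × y s q ⁻ ∈ α

    -- Unit resolution refutes z p from α, directly or through some R s p.
    Dead : Fin K → Set
    Dead p = z p ⁻ ∈ α ⊎ (ℓ ⁻ ∈ α × ∃[ s ] y s p ⁻ ∈ α)

    conflict? : Dec (∃[ s ] ∃[ q ] Conflict s q)
    conflict? = Fin.any? λ s → Fin.any? λ q → z q ⁺ ∈? α ×-dec ℓ ⁻ ∈? α ×-dec y s q ⁻ ∈? α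

    dead? : ∀ p → Dec (Dead p)
    dead? p = z p ⁻ ∈? α ⊎-dec (ℓ ⁻ ∈? α ×-dec Fin.any? λ s → y s p ⁻ ∈? α)

    ⊢₁-α : ∀ {l} → l ∈ α → (χ ∧α α) ⊢₁ (l ∷ [])
    ⊢₁-α l∈α = ⊢₁-axiom (∈-++⁺ʳ χ (∈-map⁺ (_∷ []) l∈α))

    ⊢₁-χ : ∀ {C} → C ∈ χ → (χ ∧α α) ⊢₁ C
    ⊢₁-χ = ⊢₁-axiom ∘ ∈-++⁺ˡ

    conflict⇒⊢₁⊥ : ∀ s q → Conflict s q → (χ ∧α α) ⊢₁ ⊥c
    conflict⇒⊢₁⊥ s q (z∈α , ¬ℓ∈α , ¬y∈α) =
      ⊢₁-conflict (⊢₁-χ (R∈χ s q)) (⊢₁-α z∈α ∷ ⊢₁-α ¬ℓ∈α ∷ ⊢₁-α ¬y∈α ∷ [])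

    dead⇒⊢₁¬z : ∀ {p} → Dead p → (χ ∧α α) ⊢₁ (z p ⁻ ∷ [])
    dead⇒⊢₁¬z (inj₁ ¬z∈α) = ⊢₁-α ¬z∈α
    dead⇒⊢₁¬z {p} (inj₂ (¬ℓ∈α , s , ¬y∈α)) =
      ⊢₁-unit (⊢₁-χ (R∈χ s p)) (λ { (here ()) ; (there (here ())) }) (⊢₁-α ¬ℓ∈α ∷ ⊢₁-α ¬y∈α ∷ [])

    all-dead⇒⊢₁⊥ : (∀ p → Dead p) → (χ ∧α α) ⊢₁ ⊥c
    all-dead⇒⊢₁⊥ dead = ⊢₁-conflict (⊢₁-χ (here refl)) (All.tabulate⁺ (dead⇒⊢₁¬z ∘ dead))

    -- Outside α: ℓ, every y and the live z p true, the other z false.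
    live⇒model : ∀ p → ¬ Dead p → ¬ (∃[ s ] ∃[ q ] Conflict s q) → ∃[ M ] SatCNF M (χ ∧α α)
    live⇒model p live no-conflict = α ◃ ⟦ g ⟧ , All.++⁺ (χ-sat p z-sat R-sat) α-sat
      where
        g : Var K → Bool
        g (z q) = does (q Fin.≟ p)
        g _     = true

        z-sat : LitTrue (α ◃ ⟦ g ⟧) (z p ⁺)
        z-sat = ◃-default (live ∘ inj₁) (⟦⟧-lit g (z p) (dec-true (p Fin.≟ p) refl))

        R-sat : ∀ s q → SatClause (α ◃ ⟦ g ⟧) (R s q)
        R-sat s q with ℓ ⁻ ∈? α | y s q ⁻ ∈? α | q Fin.≟ p
        ... | no ¬ℓ∉α | _       | _       = there (here (◃-default ¬ℓ∉α (⟦⟧-lit g ℓ refl)))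
        ... | yes _    | no ¬y∉α | _       = there (there (here (◃-default ¬y∉α (⟦⟧-lit g (y s q) refl))))
        ... | yes ¬ℓ∈α | yes ¬y∈α | yes refl = ⊥-elim (live (inj₂ (¬ℓ∈α , s , ¬y∈α)))
        ... | yes ¬ℓ∈α | yes ¬y∈α | no q≢p =
          here (◃-default (λ z∈α → no-conflict (s , q , z∈α , ¬ℓ∈α , ¬y∈α)) (⟦⟧-lit g (z q) (dec-false (q Fin.≟ p) q≢p)))

        α-sat : All (SatClause (α ◃ ⟦ g ⟧)) (map (_∷ []) α)
        α-sat = All.map⁺ (All.tabulate (here ∘ ◃-agrees pa))

    ⊨⊥⇒⊢₁⊥ : (χ ∧α α) ⊨ ⊥c → (χ ∧α α) ⊢₁ ⊥c
    ⊨⊥⇒⊢₁⊥ ⊨⊥ with conflict? | Fin.all? dead?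
    ... | yes (s , q , conflict) | _        = conflict⇒⊢₁⊥ s q conflict
    ... | no _                  | yes dead = all-dead⇒⊢₁⊥ dead
    ... | no no-conflict        | no ¬all-dead
      with p , live ← Fin.¬∀⟶∃¬ K Dead dead? ¬all-dead
      with () ← uncurry ⊨⊥ (live⇒model p live no-conflict)

  χ-URC : URC χ
  χ-URC α pa = χ-refutation.⊨⊥⇒⊢₁⊥ α pa

  R-forces-ℓ : ∀ {M s p} → SatClause M (R s p) → LitTrue M (z p ⁺) → LitTrue M (y s p ⁻) → LitTrue M (ℓ ⁺)
  R-forces-ℓ {M} {s} {p} (here ¬z)                 z⁺ _  = ⊥-elim (LitTrue-neg {M = M} {z p ⁺} z⁺ ¬z)
  R-forces-ℓ             (there (here ℓ⁺))         _  _  = ℓ⁺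
  R-forces-ℓ {M} {s} {p} (there (there (here y⁺))) _  ¬y = ⊥-elim (LitTrue-neg {M = M} {y s p ⁺} y⁺ ¬y)

  ℓ-sat : ∀ g p → g ℓ ≡ true → g (z p) ≡ true → SatCNF ⟦ g ⟧ χ
  ℓ-sat g p gℓ gz = χ-sat p (⟦⟧-lit g (z p) gz) λ _ _ → there (here (⟦⟧-lit g ℓ gℓ))

  ⟦⟧-falsifies : ∀ g v {b} → g v ≡ not b → ¬ LitTrue ⟦ g ⟧ (lit (encode v) b)
  ⟦⟧-falsifies g v gv≡¬b gv≡b = not-¬ refl (trans (sym gv≡b) (⟦⟧-lit g v gv≡¬b))

  base : Var K → Bool
  base (y _ _) = false
  base _       = true

  drop-z : Fin K → Var K → Bool
  drop-z q (z r) = not (does (r Fin.≟ q))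
  drop-z q v     = base v

  raise-y : Fin 2 → Fin K → Var K → Bool
  raise-y s q (y t r) = does (t Fin.≟ s) ∧ does (r Fin.≟ q)
  raise-y s q v       = base v

  spike : Fin K → Var K → Bool
  spike p ℓ       = false
  spike p (z q)   = does (q Fin.≟ p)
  spike p (y _ q) = does (q Fin.≟ p)

  spike-sat : ∀ p → SatCNF ⟦ spike p ⟧ χ
  spike-sat p = χ-sat p (⟦⟧-lit (spike p) (z p) (dec-true (p Fin.≟ p) refl)) R-sat
    where
      R-sat : ∀ s q → SatClause ⟦ spike p ⟧ (R s q)
      R-sat s q with q Fin.≟ p
      ... | yes refl = there (there (here (⟦⟧-lit (spike p) (y s q) (dec-true (q Fin.≟ q) refl))))
      ... | no q≢p   = here (⟦⟧-lit (spike p) (z q) (dec-false (q Fin.≟ p) q≢p))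

  y-injective : ∀ {s t : Fin 2} {p q : Fin K} → y s p ≡ y t q → s ≡ t × p ≡ q
  y-injective refl = refl , refl

  module Signs (σ : Fin K → Fin 2) where

    w : Fin K → Literal N
    w p = y (σ p) p ⁺

    ασ : List (Literal N)
    ασ = tabulate (neg ∘ w)

    ασ-negative : ∀ {x} → x ∈ ασ → pol x ≡ false
    ασ-negative x∈ασ with _ , refl ← ∈-tabulate⁻ x∈ασ = refl

    ασ-partial : PartialAssignment ασ
    ασ-partial (lit _ true)  x∈ασ  _     with () ← ασ-negative x∈ασ
    ασ-partial (lit _ false) _     ¬x∈ασ with () ← ασ-negative ¬x∈ασ

    ℓ⁺∉ασ : ℓ ⁺ ∉ ασ
    ℓ⁺∉ασ ℓ⁺∈ασ with () ← ασ-negative ℓ⁺∈ασ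

    ℓ⁻∉ασ : ℓ ⁻ ∉ ασ
    ℓ⁻∉ασ ℓ⁻∈ασ with q , eq ← ∈-tabulate⁻ ℓ⁻∈ασ with () ← encode-injective {ℓ} {y (σ q) q} (cong var eq)

    neg∈ασ⇒w : ∀ {x} → neg x ∈ ασ → ∃[ q ] x ≡ w q
    neg∈ασ⇒w {lit _ true}  ¬x∈ασ with q , refl ← ∈-tabulate⁻ ¬x∈ασ = q , refl
    neg∈ασ⇒w {lit _ false} ¬x∈ασ with () ← ασ-negative ¬x∈ασ

    χ∧ασ⊨ℓ : (χ ∧α ασ) ⊨ (ℓ ⁺ ∷ [])
    χ∧ασ⊨ℓ M M⊨ with M⊨χ , M⊨ασ ← All.++⁻ χ M⊨ with p , zp ← Any.tabulate⁻ (All.head M⊨χ) =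
      here (R-forces-ℓ {M} {σ p} (All.lookup M⊨χ (R∈χ (σ p) p)) zp (singleton⁻ (All.tabulate⁻ (All.map⁻ M⊨ασ) p)))

  module Countermodels (p₀ : Fin K) (other : (q : Fin K) → ∃[ r ] r ≢ q) (σ : Fin K → Fin 2) where
    open Signs σ

    Avoids : (Var K → Bool) → Set
    Avoids g = SatCNF ⟦ g ⟧ χ × (∀ q → g (y (σ q) q) ≡ false)

    base-avoids : Avoids base
    base-avoids = ℓ-sat base p₀ refl refl , λ _ → refl

    drop-z-avoids : ∀ q → Avoids (drop-z q)
    drop-z-avoids q with r , r≢q ← other q =
      ℓ-sat (drop-z q) r refl (cong not (dec-false (r Fin.≟ q) r≢q)) , λ _ → refl

    raise-y-avoids : ∀ {s q} → σ q ≢ s → Avoids (raise-y s q)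
    raise-y-avoids {s} {q} σq≢s = ℓ-sat (raise-y s q) p₀ refl refl , y-false
      where
        y-false : ∀ r → raise-y s q (y (σ r) r) ≡ false
        y-false r with r Fin.≟ q
        ... | yes refl = cong (_∧ true) (dec-false (σ q Fin.≟ s) σq≢s)
        ... | no _     = ∧-zeroʳ _

    countermodel : ∀ {x} → x ∉ ασ → x ≢ ℓ ⁺ → ∃[ g ] Avoids g × ¬ LitTrue ⟦ g ⟧ x
    countermodel {lit v _} _ _ with decode v | encode-decode v
    countermodel {lit _ true}  _ x≢ℓ | ℓ | refl = ⊥-elim (x≢ℓ refl)
    countermodel {lit _ false} _ _   | ℓ | refl = base , base-avoids , λ ()
    countermodel {lit _ true}  _ _   | z q | refl =
      drop-z q , drop-z-avoids q , λ eq → not-¬ eq (cong not (dec-true (q Fin.≟ q) refl))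
    countermodel {lit _ false} _ _   | z q | refl = base , base-avoids , λ ()
    countermodel {lit _ true}  _ _   | y s q | refl = base , base-avoids , λ ()
    countermodel {lit _ false} x∉ασ _ | y s q | refl with σ q Fin.≟ s
    ... | yes refl = ⊥-elim (x∉ασ (∈-tabulate⁺ q))
    ... | no σq≢s  = raise-y s q , raise-y-avoids σq≢s ,
                     λ eq → not-¬ eq (cong₂ _∧_ (dec-true (s Fin.≟ s) refl) (dec-true (q Fin.≟ q) refl))

    -- A clause implied by χ that propagates under ασ is exactly ℓ ∨ w₁ ∨ … ∨ w_K.
    module ClauseShape {E : Clause N} (χ⊨E : χ ⊨ E) (E-prop : Propagating ασ E) where
      open Propagating E-prop

      no-countermodel : ∀ {g} → Avoids g → ¬ (∀ {x} → x ∈ E → neg x ∉ ασ → ¬ LitTrue ⟦ g ⟧ x)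
      no-countermodel {g} (g⊨χ , w-false) free-false
        with x , x∈E , x-true ← find (χ⊨E ⟦ g ⟧ g⊨χ) | neg x ∈? ασ
      ... | no ¬x∉ασ = free-false x∈E ¬x∉ασ x-true
      ... | yes ¬x∈ασ with q , refl ← neg∈ασ⇒w ¬x∈ασ = ⟦⟧-falsifies g (y (σ q) q) (w-false q) x-true

      ℓ⁺∈E : ℓ ⁺ ∈ E
      ℓ⁺∈E with any? (λ x → ¬? (neg x ∈? ασ)) E
      ... | no no-free = ⊥-elim (no-countermodel {base} base-avoids λ x∈E ¬x∉ασ _ → no-free (lose x∈E ¬x∉ασ))
      ... | yes some-free with x , x∈E , ¬x∉ασ ← find some-free | x ≟L ℓ ⁺
      ...   | yes refl = x∈E
      ...   | no x≢ℓ with g , g-avoids , x-false ← countermodel (unsatisfied x∈E) x≢ℓ =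
        ⊥-elim (no-countermodel {g} g-avoids λ x′∈E ¬x′∉ασ →
                  subst (¬_ ∘ LitTrue ⟦ g ⟧) (unfalsified-unique x∈E x′∈E ¬x∉ασ ¬x′∉ασ) x-false)

      E⊆ℓw : ∀ {x} → x ∈ E → x ≡ ℓ ⁺ ⊎ ∃[ q ] x ≡ w q
      E⊆ℓw {x} x∈E with neg x ∈? ασ
      ... | yes ¬x∈ασ = inj₂ (neg∈ασ⇒w ¬x∈ασ)
      ... | no ¬x∉ασ  = inj₁ (unfalsified-unique x∈E ℓ⁺∈E ¬x∉ασ ℓ⁻∉ασ)

      w∈E : ∀ p → w p ∈ E
      w∈E p with x , x∈E , x-true ← find (χ⊨E ⟦ spike p ⟧ (spike-sat p)) with E⊆ℓw x∈E
      ... | inj₁ refl = ⊥-elim (⟦⟧-falsifies (spike p) ℓ refl x-true)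
      ... | inj₂ (q , refl) with q Fin.≟ p
      ...   | yes refl = x∈E
      ...   | no q≢p   = ⊥-elim (⟦⟧-falsifies (spike p) (y (σ q) q) (dec-false (q Fin.≟ p) q≢p) x-true)

  PC-equivalent-size : Fin K → ((q : Fin K) → ∃[ r ] r ≢ q) → ∀ {ψ} → PC ψ → Equivalent χ ψ → 2 ^ K ≤ size ψ
  PC-equivalent-size p₀ other {ψ} ψ-PC χ≡ψ = ^≤length ψ E E∈ψ E-injective
    where
      open Signs

      χ⊨ : ∀ {C} → C ∈ ψ → χ ⊨ C
      χ⊨ C∈ψ M M⊨χ = All.lookup (to (χ≡ψ M) M⊨χ) C∈ψ

      witness : ∀ σ → Σ (Clause N) λ E → E ∈ ψ × Propagating (ασ σ) E
      witness σ = find (PC⇒propagating ψ-PC (ασ-partial σ) (ℓ⁺∉ασ σ) (⊨-∧α-equivalent χ≡ψ (χ∧ασ⊨ℓ σ)))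

      E : (Fin K → Fin 2) → Clause N
      E σ = proj₁ (witness σ)

      E∈ψ : ∀ σ → E σ ∈ ψ
      E∈ψ σ = proj₁ (proj₂ (witness σ))

      module Shape (σ : Fin K → Fin 2) = Countermodels.ClauseShape p₀ other σ (χ⊨ (E∈ψ σ)) (proj₂ (proj₂ (witness σ)))

      E-injective : ∀ {σ τ} → E σ ≡ E τ → ∀ p → σ p ≡ τ p
      E-injective {σ} {τ} Eσ≡Eτ p with Shape.E⊆ℓw τ (subst (w σ p ∈_) Eσ≡Eτ (Shape.w∈E σ p))
      ... | inj₁ wσp≡ℓ with () ← encode-injective {y (σ p) p} {ℓ} (cong var wσp≡ℓ)
      ... | inj₂ (q , wσp≡wτq) with y-injective (encode-injective {y (σ p) p} {y (τ q) q} (cong var wσp≡wτq))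
      ...   | σp≡τq , refl = σp≡τq

PC-equivalent-χ-size : ∀ K → 2 ≤ K → ∀ {ψ} → PC ψ → Equivalent (Family.χ K) ψ → 2 ^ K ≤ size ψ
PC-equivalent-χ-size (suc (suc K)) (s≤s (s≤s z≤n)) = Family.PC-equivalent-size (2 + K) zero λ q → punchIn q zero , Fin.punchInᵢ≢i q zero

n<2^n : ∀ n → n < 2 ^ n
n<2^n zero    = s≤s z≤n
n<2^n (suc n) = +-mono-≤ (m^n>0 2 n) (≤-trans (n<2^n n) (m≤m+n (2 ^ n) 0))

linear<2^ : ∀ a → ∃[ t ] a * suc t < 2 ^ t
linear<2^ zero = 0 , s≤s z≤n
linear<2^ (suc a) with t , a[1+t]<2^t ← linear<2^ a = 3 + t , (begin-strict
    (4 + t) + a * (4 + t)    ≤⟨ +-monoʳ-≤ (4 + t) (*-monoʳ-≤ a (+-monoʳ-≤ 4 (m≤n*m t 4))) ⟩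
    (4 + t) + a * (4 + 4 * t) ≡⟨ regroup a t ⟩
    t + 4 * suc (a * suc t)  ≤⟨ +-monoʳ-≤ t (*-monoʳ-≤ 4 a[1+t]<2^t) ⟩
    t + 4 * 2 ^ t            <⟨ +-monoˡ-< (4 * 2 ^ t) (n<2^n t) ⟩
    2 ^ t + 4 * 2 ^ t        ≤⟨ m≤m+n (2 ^ t + 4 * 2 ^ t) (3 * 2 ^ t) ⟩
    2 ^ t + 4 * 2 ^ t + 3 * 2 ^ t ≡⟨ eight (2 ^ t) ⟩
    2 ^ (3 + t)              ∎)
  where
    open ≤-Reasoning
    regroup : ∀ a t → (4 + t) + a * (4 + 4 * t) ≡ t + 4 * suc (a * suc t)
    regroup = solve-∀
    eight : ∀ x → x + 4 * x + 3 * x ≡ 2 * (2 * (2 * x))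
    eight = solve-∀

poly<2^ : ∀ c k → ∃[ K ] 2 ≤ K × c * suc (K + K) ^ k + c < 2 ^ K
poly<2^ c k with t , a[1+t]<2^t ← linear<2^ (suc c + 2 * k) = 2 ^ t , 2≤2^t , (begin-strict
    c * Y + c                        ≤⟨ +-monoʳ-≤ (c * Y) (≤-trans (≤-reflexive (sym (*-identityʳ c))) (*-monoʳ-≤ c (m^n>0 (suc (X + X)) k))) ⟩
    c * Y + c * Y                    ≡⟨ double c Y ⟩
    2 * c * Y                        ≤⟨ *-monoˡ-≤ Y (*-monoʳ-≤ 2 (<⇒≤ (n<2^n c))) ⟩
    2 ^ suc c * Y                    ≤⟨ *-monoʳ-≤ (2 ^ suc c) (≤-trans (^-monoˡ-≤ k 1+2X≤) (≤-reflexive (^-*-assoc 2 (2 + t) k))) ⟩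
    2 ^ suc c * 2 ^ ((2 + t) * k)    ≡⟨ sym (^-distribˡ-+-* 2 (suc c) ((2 + t) * k)) ⟩
    2 ^ (suc c + (2 + t) * k)        <⟨ ^-monoʳ-< 2 (s≤s (s≤s z≤n)) exponent< ⟩
    2 ^ X                            ∎)
  where
    open ≤-Reasoning
    X = 2 ^ t
    Y = suc (X + X) ^ k

    2≤2^t : 2 ≤ X
    2≤2^t = ≤-trans (s≤s (s≤s z≤n)) (≤-<-trans (m≤n*m (suc t) (suc c + 2 * k)) a[1+t]<2^t)

    1+2X≤ : suc (X + X) ≤ 2 ^ (2 + t)
    1+2X≤ = ≤-trans (+-monoˡ-≤ (X + X) (≤-trans (m^n>0 2 t) (m≤m+n X X))) (≤-reflexive (quadruple X))
      where
        quadruple : ∀ x → (x + x) + (x + x) ≡ 2 * (2 * x)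
        quadruple = solve-∀

    exponent< : suc c + (2 + t) * k < X
    exponent< = ≤-<-trans (≤-trans (m≤m+n _ ((suc c + k) * t)) (≤-reflexive (expand c k t))) a[1+t]<2^t
      where
        expand : ∀ c k t → (suc c + (2 + t) * k) + (suc c + k) * t ≡ (suc c + 2 * k) * suc t
        expand = solve-∀

    double : ∀ c y → c * y + c * y ≡ 2 * c * y
    double = solve-∀

theorem1 : AtLeastAsSuccinct (λ φ → URC φ) (λ φ → PC φ) × ¬ AtLeastAsSuccinct (λ φ → PC φ) (λ φ → URC φ)
theorem1 = (1 , 1 , λ _ φ φ-PC → φ , PC⇒URC φ-PC , (λ _ → ⇔.refl) , size≤) , no-PC-compilation
  where
    size≤ : ∀ {m} → m ≤ 1 * m ^ 1 + 1
    size≤ {m} = ≤-trans (m≤m+n m 1) (≤-reflexive (cong (_+ 1) (sym (trans (*-identityˡ (m ^ 1)) (^-identityʳ m)))))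

    no-PC-compilation : ¬ AtLeastAsSuccinct (λ φ → PC φ) (λ φ → URC φ)
    no-PC-compilation (c , k , compile)
      with K , 2≤K , small ← poly<2^ c k
      with ψ , ψ-PC , χ≡ψ , ψ-size ← compile _ (Family.χ K) (Family.χ-URC K) = <-irrefl refl (begin-strict
        2 ^ K                 ≤⟨ PC-equivalent-χ-size K 2≤K ψ-PC χ≡ψ ⟩
        size ψ                ≤⟨ ψ-size ⟩
        c * size (Family.χ K) ^ k + c ≡⟨ cong (λ m → c * m ^ k + c) (Family.size-χ K) ⟩
        c * suc (K + K) ^ k + c <⟨ small ⟩
        2 ^ K                 ∎)
      where open ≤-Reasoning
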